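{- Let $\theta:W\to W$ be defined recursively by $\theta(\varepsilon)=\varepsilon$ for the empty word $\varepsilon$ and, for nonempty $w\in W$, $$\theta(w)=\theta(w\setminus\mathsf{srw}(w))*\delta_d(\mathsf{srw}(w)),\qquad d=\mathsf{srdes}(w),$$ where $*$ is concatenation and, if $c_1<c_2<\cdots<c_m$ are the entries of $\mathsf{srw}(w)$, $\delta_d(\mathsf{srw}(w))=c_{d+1}c_1c_2\cdots c_dc_{d+2}\cdots c_m$. Then $\theta$ is a well-defined bijection of $W$ such that $\mathsf{des}(w)=\mathsf{lec}(\theta(w))$ for all $w\in W$. Moreover, the restriction of $\theta$ to the symmetric group $\mathcal S_n$ (permutations written in one-line notation) is a bijection $\mathcal S_n\to\mathcal S_n$.
   Context: $W$ is the set of all finite words ($\ell\ge0$) of positive integers with pairwise distinct entries. For $u=u_1\cdots u_\ell$, $\mathsf{des}(u)=\#\{j\in[\ell-1]:u_j>u_{j+1}\}$ and $\mathsf{inv}(u)=\#\{(p,q):p<q,\ u_p>u_q\}$. Special reverse wave: let $w=w_1\cdots w_\ell\in W$ be nonempty. If the entries of $w$ are increasing, $\mathsf{srw}(w)=w$ (and $s:=\ell$). Otherwise let $t$ be the minimal index with $w_t>w_{t+1}$, set $w_0=0$, and let $s$ be the maximal index with $t\le s\le \ell$ such that $w_t>w_{t+1}>\cdots>w_s>w_{t-1}$; then $\mathsf{srw}(w)=w_1\cdots w_s$. $w\setminus\mathsf{srw}(w)$ is the suffix $w_{s+1}\cdots w_\ell$. $\mathsf{srdes}(w)=\mathsf{des}(\mathsf{srw}(w))+\chi$,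 where $\chi=1$ if $s<\ell$ and $w_s>w_{s+1}$, else $\chi=0$. Hook factorization: every $w\in W$ decomposes uniquely as $w=\gamma*\alpha_1*\cdots*\alpha_m$ with $\gamma$ a possibly empty increasing word and each $\alpha_j=a_1\cdots a_r$ a hook ($r\ge2$, $a_1>a_2$, $a_2<\cdots<a_r$); $\mathsf{lec}(w)=\sum_j\mathsf{inv}(\alpha_j)$. -}

module Defs where

open import Data.Nat using (ℕ; zero; suc; _+_; _<ᵇ_; _<_; _≤_)
open import Data.Nat.Properties using (≤-decTotalOrder; _<?_)
open import Data.Bool using (Bool; true; false; if_then_else_)
open import Data.List using (List; []; _∷_; _++_; length; filter; reverse; splitAt; map; upTo)
open import Data.List.Relation.Unary.All using (All)
open import Data.List.Relation.Unary.Unique.Propositional using (Unique)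
open import Data.List.Relation.Binary.Permutation.Propositional using (_↭_)
open import Data.Nat.ListAction using (sum)
open import Data.Maybe using (Maybe; just; nothing)
open import Data.Product using (_×_; _,_; proj₁; proj₂)
open import Data.List.Sort.InsertionSort ≤-decTotalOrder using (sort)

Word : Set
Word = List ℕ

InW : Word → Set
InW w = All (1 ≤_) w × Unique w

InS : ℕ → Word → Set
InS n w = w ↭ map suc (upTo n)

des : Word → ℕ
des [] = 0
des (x ∷ []) = 0
des (x ∷ y ∷ xs) = (if y <ᵇ x then 1 else 0) + des (y ∷ xs)

inv : Word → ℕ
inv [] = 0
inv (x ∷ xs) = length (filter (_<? x) xs) + inv xs

-- descending phase: p = w_{t-1}, c = current last taken entry
srwDec : ℕ → ℕ → Word → Word × Word
srwDec p c [] = [] , []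
srwDec p c (y ∷ ys) with y <ᵇ c | p <ᵇ y
... | true | true = let r = srwDec p y ys in (y ∷ proj₁ r) , proj₂ r
... | _    | _    = [] , (y ∷ ys)

-- increasing phase: p = previous entry (w_0 = 0 initially)
srwStep : ℕ → ℕ → Word → Word × Word
srwStep p x [] = (x ∷ []) , []
srwStep p x (y ∷ ys) =
  if y <ᵇ x
  then (let r = srwDec p x (y ∷ ys) in (x ∷ proj₁ r) , proj₂ r)
  else (let r = srwStep x y ys in (x ∷ proj₁ r) , proj₂ r)

srwInc : ℕ → Word → Word × Word
srwInc p [] = [] , []
srwInc p (x ∷ xs) = srwStep p x xs

srwSplit : Word → Word × Word
srwSplit w = srwInc 0 w

srw : Word → Word
srw w = proj₁ (srwSplit w)

srwRest : Word → Word
srwRest w = proj₂ (srwSplit w)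

last : Word → Maybe ℕ
last [] = nothing
last (x ∷ []) = just x
last (x ∷ y ∷ xs) = last (y ∷ xs)

χ : Word → Word → ℕ
χ u [] = 0
χ u (y ∷ _) with last u
... | nothing = 0
... | just x  = if y <ᵇ x then 1 else 0

srdes : Word → ℕ
srdes w = des (srw w) + χ (srw w) (srwRest w)

δ : ℕ → Word → Word
δ d u with splitAt d (sort u)
... | pre , (x ∷ post) = x ∷ (pre ++ post)
... | pre , []         = pre

-- θ, defined by recursion on the length (the remainder w ∖ srw w is
-- strictly shorter than w when w is nonempty, so fuel = length w suffices)

θ-fuel : ℕ → Word → Word
θ-fuel zero w = []
θ-fuel (suc n) [] = []
θ-fuel (suc n) (x ∷ xs) =
  θ-fuel n (srwRest (x ∷ xs)) ++ δ (srdes (x ∷ xs)) (srw (x ∷ xs))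

θ : Word → Word
θ w = θ-fuel (length w) w

-- Hook factorization w = γ * α₁ * ⋯ * α_m, computed from the right:
-- α_m starts at the last descent of w.  We work on the reversed word.
-- lastHook run r : run is the current increasing suffix (original order),
-- r is the reversed remaining prefix; returns (α_m , reversed rest).
lastHook : Word → Word → Maybe (Word × Word)
lastHook run [] = nothing
lastHook [] (x ∷ xs) = lastHook (x ∷ []) xs
lastHook (a ∷ run) (x ∷ xs) with a <ᵇ x
... | true  = just ((x ∷ a ∷ run) , xs)
... | false = lastHook (x ∷ a ∷ run) xs

hooksRev : ℕ → Word → List Word
hooksRev zero r = []
hooksRev (suc n) r with lastHook [] r
... | nothing = []
... | just (h , r') = hooksRev n r' Data.List.∷ʳ h

hooks : Word → List Word
hooks w = hooksRev (length w) (reverse w)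

lec : Word → ℕ
lec w = sum (map inv (hooks w))

-- θ removes the special reverse wave u = srw w and appends δ_d(u) with d = srdes w.  Since
-- des w = srdes w + des (w ∖ u), the identity des = lec ∘ θ follows by induction once δ_d(u)
-- contributes exactly d to lec: for d ≥ 1 it is a hook with d inversions (the wave has more
-- than d letters because letters are positive) and it is the last hook of θ w; for d = 0 the
-- word is a single increasing wave and θ w = w.
--
-- For bijectivity, the last hook of θ w gives back δ_d(u), hence d, the letters of u and
-- θ (w ∖ u).  A wave is determined by its letters, its srdes and the word following it: its
-- decreasing run has d letters after its top if the next letter does not descend, and d − 1
-- otherwise, and both cannot happen since the letter separating the two candidates would then
-- occur twice.  Conversely such a wave always exists, which inverts θ hook by hook.

module Submission where

open import Defs
open import Data.Bool using (true; false; if_then_else_; T)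
open import Data.Bool.Properties using (T-≡)
open import Data.Empty using (⊥-elim)
open import Data.List
  using ([]; _∷_; [_]; _++_; length; filter; reverse; splitAt; take; drop; map; upTo; _∷ʳ_; head)
open import Data.List.Properties
  using (++-assoc; ++-identityʳ; length-++; map-++; reverse-++; length-reverse; unfold-reverse;
         reverse-involutive; reverse-injective; splitAt-defn; take++drop≡id; ∷-injective;
         filter-++; filter-all; filter-none; filter-accept; length-++-sucʳ; length-++-≤ˡ)
open import Data.List.Relation.Binary.Permutation.Propositional
  using (_↭_; ↭-refl; ↭-sym; ↭-trans; ↭-reflexive; ↭⇒↭ₛ; module PermutationReasoning)
import Data.List.Relation.Binary.Permutation.Propositional.Properties as ↭
import Data.List.Relation.Binary.Permutation.Setoid.Properties as PermSetoid
open import Data.List.Relation.Binary.Pointwise using (Pointwise-≡⇒≡)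
open import Data.List.Relation.Unary.All as All using (All; []; _∷_)
import Data.List.Relation.Unary.All.Properties as All
open import Data.List.Relation.Unary.AllPairs as AllPairs using (AllPairs; []; _∷_)
import Data.List.Relation.Unary.AllPairs.Properties as AllPairs
open import Data.List.Relation.Unary.Linked as Linked using (Linked; []; [-]; _∷_; _∷′_)
import Data.List.Relation.Unary.Linked.Properties as Linked
open import Data.List.Relation.Unary.Unique.Propositional using (Unique)
import Data.List.Relation.Unary.Unique.Propositional.Properties as Unique
open import Data.List.Membership.Propositional using (_∈_)
open import Data.List.Membership.Propositional.Properties using (∈-++⁺ˡ; ∈-++⁺ʳ)
open import Data.List.Relation.Unary.Any using (here)
open import Data.Maybe using (just; nothing)
open import Data.Maybe.Relation.Binary.Connected using (Connected; just)
open import Data.Nat using (ℕ; zero; suc; _+_; _<ᵇ_; _<_; _≤_; _>_; z≤n; s≤s)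
open import Data.Nat.ListAction using (sum)
open import Data.Nat.ListAction.Properties using (sum-++)
open import Data.Nat.Properties
open import Data.List.Sort.InsertionSort ≤-decTotalOrder using (sort)
open import Data.List.Sort.InsertionSort.Properties ≤-decTotalOrder using (sort-↭; sort-↗)
open import Data.List.Relation.Unary.Sorted.TotalOrder ≤-totalOrder using (Sorted)
import Data.List.Relation.Unary.Sorted.TotalOrder.Properties as Sorted
open import Data.Product using (_×_; _,_; proj₁; proj₂; Σ; ∃; uncurry; map₁)
open import Data.Sum using (inj₁; inj₂)
open import Data.Maybe.Properties using (just-injective)
open import Function.Base using (_∘_)
open import Function.Bundles using (Equivalence)
open import Relation.Binary.Definitions using (tri<; tri≈; tri>)
open import Relation.Nullary using (yes; no)
open import Relation.Binary.PropositionalEquality hiding ([_])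

<ᵇ≡true⇒< : ∀ {m n} → (m <ᵇ n) ≡ true → m < n
<ᵇ≡true⇒< {m} {n} e = <ᵇ⇒< m n (Equivalence.from T-≡ e)

<⇒<ᵇ≡true : ∀ {m n} → m < n → (m <ᵇ n) ≡ true
<⇒<ᵇ≡true m<n = Equivalence.to T-≡ (<⇒<ᵇ m<n)

<ᵇ≡false⇒≥ : ∀ {m n} → (m <ᵇ n) ≡ false → n ≤ m
<ᵇ≡false⇒≥ e = ≮⇒≥ (λ m<n → subst T e (<⇒<ᵇ m<n))

≥⇒<ᵇ≡false : ∀ {m n} → n ≤ m → (m <ᵇ n) ≡ false
≥⇒<ᵇ≡false {m} {n} n≤m with m <ᵇ n in e
... | true  = ⊥-elim (<⇒≱ (<ᵇ≡true⇒< e) n≤m)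
... | false = refl

if-elim : ∀ {A : Set} (P : A → Set) b {t e : A} →
          (b ≡ true → P t) → (b ≡ false → P e) → P (if b then t else e)
if-elim P true  onTrue _       = onTrue refl
if-elim P false _      onFalse = onFalse refl

if-true : ∀ {A : Set} {b} {t e : A} → b ≡ true → (if b then t else e) ≡ t
if-true refl = refl

reverse-∷-++ : ∀ x (xs ys : Word) → reverse (x ∷ xs) ++ ys ≡ reverse xs ++ x ∷ ys
reverse-∷-++ x xs ys = trans (cong (_++ ys) (unfold-reverse x xs)) (++-assoc (reverse xs) (x ∷ []) ys)

Linked-++⁻ʳ : ∀ {R : ℕ → ℕ → Set} xs {ys} → Linked R (xs ++ ys) → Linked R ys
Linked-++⁻ʳ []       l = l
Linked-++⁻ʳ (x ∷ xs) l = Linked-++⁻ʳ xs (Linked.tail l)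

head-++-∷ : ∀ (xs : Word) {z} ys zs → head (xs ++ z ∷ ys) ≡ head (xs ++ z ∷ zs)
head-++-∷ []      _ _ = refl
head-++-∷ (_ ∷ _) _ _ = refl

head-++ˡ : ∀ (xs : Word) {ys a} → head xs ≡ just a → head (xs ++ ys) ≡ just a
head-++ˡ (_ ∷ _) e = e

++-≡-++ : ∀ (xs₁ ys₁ xs₂ ys₂ : Word) → xs₁ ++ ys₁ ≡ xs₂ ++ ys₂ → length xs₂ ≤ length xs₁ →
          ∃ λ mid → xs₁ ≡ xs₂ ++ mid × ys₂ ≡ mid ++ ys₁
++-≡-++ xs₁       ys₁ []        ys₂ e _ = xs₁ , refl , sym e
++-≡-++ (a ∷ xs₁) ys₁ (b ∷ xs₂) ys₂ e (s≤s le) with ∷-injective e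
... | refl , e′ with ++-≡-++ xs₁ ys₁ xs₂ ys₂ e′ le
...   | mid , refl , refl = mid , refl , refl

splitAt-++ : ∀ n (xs : Word) {ys zs} → splitAt n xs ≡ (ys , zs) → ys ++ zs ≡ xs
splitAt-++ n xs {ys} {zs} eq = begin
  ys ++ zs                    ≡⟨ cong (uncurry _++_) (sym eq) ⟩
  uncurry _++_ (splitAt n xs) ≡⟨ cong (uncurry _++_) (splitAt-defn n xs) ⟩
  take n xs ++ drop n xs      ≡⟨ take++drop≡id n xs ⟩
  xs                          ∎
  where open ≡-Reasoning

splitAt-length : ∀ (xs ys : Word) → splitAt (length xs) (xs ++ ys) ≡ (xs , ys)
splitAt-length []       ys = refl
splitAt-length (x ∷ xs) ys rewrite splitAt-length xs ys = refl

split-at-index : ∀ d (S : Word) → d < length S →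
                 ∃ λ pre → ∃ λ x → ∃ λ post → S ≡ pre ++ x ∷ post × length pre ≡ d
split-at-index zero    (x ∷ S) _ = [] , x , S , refl , refl
split-at-index (suc d) (y ∷ S) (s≤s d<|S|) with split-at-index d S d<|S|
... | pre , x , post , refl , refl = y ∷ pre , x , post , refl , refl

split-from-end : ∀ d (S : Word) → d < length S →
                 ∃ λ A → ∃ λ y → ∃ λ B → S ≡ A ++ y ∷ B × length B ≡ d
split-from-end d (s ∷ S) (s≤s d≤|S|) with d <? length S
... | yes d<|S| with split-from-end d S d<|S|
...   | A , y , B , refl , refl = s ∷ A , y , B , refl , refl
split-from-end d (s ∷ S) (s≤s d≤|S|) | no d≮|S| = [] , s , S , refl , ≤-antisym (≮⇒≥ d≮|S|) d≤|S|

lastOr : ℕ → Word → ℕ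
lastOr z []       = z
lastOr z (y ∷ ys) = lastOr y ys

last-++-∷ : ∀ xs z ys → last (xs ++ z ∷ ys) ≡ just (lastOr z ys)
last-++-∷ []           z []       = refl
last-++-∷ []           z (y ∷ ys) = last-++-∷ [] y ys
last-++-∷ (x ∷ [])     z ys       = last-++-∷ [] z ys
last-++-∷ (x ∷ x′ ∷ xs) z ys      = last-++-∷ (x′ ∷ xs) z ys

lastOr-++-∷ : ∀ p xs z → lastOr p (xs ++ [ z ]) ≡ z
lastOr-++-∷ p []       z = refl
lastOr-++-∷ p (x ∷ xs) z = lastOr-++-∷ x xs z

All-lastOr : ∀ {P : ℕ → Set} z ys → P z → All P ys → P (lastOr z ys)
All-lastOr z []       pz []         = pz
All-lastOr z (y ∷ ys) pz (py ∷ pys) = All-lastOr y ys py pys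

All-lastOr-< : ∀ p A {ys} → All (p <_) ys → All (λ a → All (a <_) ys) A → All (lastOr p A <_) ys
All-lastOr-< p []      p<ys []             = p<ys
All-lastOr-< p (a ∷ A) _    (a<ys ∷ cross) = All-lastOr-< a A a<ys cross

head-reverse : ∀ z ys → head (reverse (z ∷ ys)) ≡ just (lastOr z ys)
head-reverse z []       = refl
head-reverse z (y ∷ ys) =
  trans (cong head (unfold-reverse z (y ∷ ys))) (head-++ˡ (reverse (y ∷ ys)) (head-reverse y ys))

∷ʳ-view : ∀ (l : Word) b →
          ∃ λ top → ∃ λ dec → l ∷ʳ b ≡ top ∷ dec × lastOr top dec ≡ b × length dec ≡ length l
∷ʳ-view []      b = b , [] , refl , refl , refl
∷ʳ-view (c ∷ l) b = c , l ∷ʳ b , refl , lastOr-++-∷ c l b , trans (length-++ l) (+-comm (length l) 1)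

reverse-view : ∀ b (B : Word) →
               ∃ λ top → ∃ λ dec → reverse (b ∷ B) ≡ top ∷ dec × lastOr top dec ≡ b × length dec ≡ length B
reverse-view b B with ∷ʳ-view (reverse B) b
... | top , dec , e , m≡b , k≡ = top , dec , trans (unfold-reverse b B) e , m≡b , trans k≡ (length-reverse B)

AllPairs-++⁻ : ∀ {R : ℕ → ℕ → Set} xs {ys} → AllPairs R (xs ++ ys) →
               AllPairs R xs × AllPairs R ys × All (λ x → All (R x) ys) xs
AllPairs-++⁻ []       ap       = [] , ap , []
AllPairs-++⁻ (x ∷ xs) (a ∷ ap) with AllPairs-++⁻ xs ap | All.++⁻ xs a
... | apxs , apys , cross | axs , ays = axs ∷ apxs , apys , ays ∷ cross

AllPairs-delete : ∀ {R : ℕ → ℕ → Set} pre {x post} → AllPairs R (pre ++ x ∷ post) → AllPairs R (pre ++ post)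
AllPairs-delete pre ap with AllPairs-++⁻ pre ap
... | appre , _ ∷ appost , cross = AllPairs.++⁺ appre appost (All.map All.tail cross)

AllPairs-insert : ∀ {R : ℕ → ℕ → Set} pre {a post} → AllPairs R (pre ++ post) →
                  All (λ x → R x a) pre → All (R a) post → AllPairs R (pre ++ a ∷ post)
AllPairs-insert pre ap pre-a a-post with AllPairs-++⁻ pre ap
... | appre , appost , cross =
  AllPairs.++⁺ appre (a-post ∷ appost) (All.zipWith (λ (xa , x-post) → xa ∷ x-post) (pre-a , cross))

Unique-++⇒≢ : ∀ xs {ys x y} → Unique (xs ++ ys) → x ∈ xs → y ∈ ys → x ≢ y
Unique-++⇒≢ xs uq x∈xs y∈ys = All.lookup (All.lookup (proj₂ (proj₂ (AllPairs-++⁻ xs uq))) x∈xs) y∈ys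

strictly-sorted : ∀ {xs} → Sorted xs → Unique xs → AllPairs _<_ xs
strictly-sorted s u = AllPairs.zipWith (uncurry ≤∧≢⇒<) (Sorted.Sorted⇒AllPairs ≤-totalOrder s , u)

strict⇒sorted : ∀ {xs} → AllPairs _<_ xs → Sorted xs
strict⇒sorted ap = Sorted.AllPairs⇒Sorted ≤-totalOrder (AllPairs.map <⇒≤ ap)

↗↭↗⇒≡ : ∀ {xs ys} → Sorted xs → Sorted ys → xs ↭ ys → xs ≡ ys
↗↭↗⇒≡ xs↗ ys↗ xs↭ys = Pointwise-≡⇒≡ (Sorted.↗↭↗⇒≋ ≤-totalOrder xs↗ ys↗ (↭⇒↭ₛ xs↭ys))

↭⇒sort≡ : ∀ {u v} → u ↭ v → sort u ≡ sort v
↭⇒sort≡ {u} {v} u↭v =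
  ↗↭↗⇒≡ (sort-↗ u) (sort-↗ v) (↭-trans (sort-↭ u) (↭-trans u↭v (↭-sym (sort-↭ v))))

Sorted-insert : ∀ p inc {d z ys} → lastOr p inc ≤ d → d ≤ z →
                Sorted (inc ++ z ∷ ys) → Sorted (inc ++ d ∷ z ∷ ys)
Sorted-insert p []            _   d≤z s         = d≤z ∷ s
Sorted-insert p (i ∷ [])      i≤d d≤z (_ ∷ s)   = i≤d ∷ d≤z ∷ s
Sorted-insert p (i ∷ j ∷ inc) le  d≤z (i≤j ∷ s) = i≤j ∷ Sorted-insert i (j ∷ inc) le d≤z s

Sorted-++-reverse : ∀ p inc z dec {ys} → Linked _>_ (z ∷ dec) → All (lastOr p inc <_) dec →
                    Sorted (inc ++ z ∷ ys) → Sorted (inc ++ reverse dec ++ z ∷ ys)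
Sorted-++-reverse p inc z []        _         _         s = s
Sorted-++-reverse p inc z (d ∷ dec) {ys} (z>d ∷ l) (q<d ∷ a) s =
  subst (λ v → Sorted (inc ++ v)) (sym (reverse-∷-++ d dec (z ∷ ys)))
    (Sorted-++-reverse p inc d dec l a (Sorted-insert p inc (<⇒≤ q<d) (<⇒≤ z>d) s))

reverse-increasing : ∀ {xs} → AllPairs _<_ xs → AllPairs _>_ (reverse xs)
reverse-increasing [] = []
reverse-increasing {x ∷ xs} (x<xs ∷ ap) = subst (AllPairs _>_) (sym (unfold-reverse x xs))
  (AllPairs.++⁺ (reverse-increasing ap) ([] ∷ [])
    (All.map (_∷ []) (↭.All-resp-↭ (↭-sym (↭.↭-reverse xs)) x<xs)))

span-around : ∀ a {L} → Sorted L → All (a ≢_) L →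
              ∃ λ pre → ∃ λ post → L ≡ pre ++ post × All (_< a) pre × All (a <_) post
span-around a {[]}    _ _ = [] , [] , refl , [] , []
span-around a {c ∷ L} s (a≢c ∷ a≢L) with c <? a
... | yes c<a with span-around a (Linked.tail s) a≢L
...   | pre , post , refl , pre<a , a<post = c ∷ pre , post , refl , c<a ∷ pre<a , a<post
span-around a {c ∷ L} s (a≢c ∷ _) | no c≮a =
  [] , c ∷ L , refl , [] , All.map (<-≤-trans a<c) (Linked.Linked⇒All ≤-trans ≤-refl s)
  where
  a<c : a < c
  a<c = ≤∧≢⇒< (≮⇒≥ c≮a) a≢c

InW-↭ : ∀ {xs ys} → xs ↭ ys → InW xs → InW ys
InW-↭ p (positive , unique) = ↭.All-resp-↭ p positive , PermSetoid.Unique-resp-↭ (setoid ℕ) (↭⇒↭ₛ p) unique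

InW-++⁻ : ∀ u {r} → InW (u ++ r) → InW u × InW r
InW-++⁻ u (positive , unique) with AllPairs-++⁻ u unique
... | uu , ur , _ = (All.++⁻ˡ u positive , uu) , (All.++⁻ʳ u positive , ur)

-- Descents and inversions

χ-++-∷ : ∀ xs z ys r → χ (xs ++ z ∷ ys) r ≡ χ [ lastOr z ys ] r
χ-++-∷ xs z ys []      = refl
χ-++-∷ xs z ys (f ∷ t) rewrite last-++-∷ xs z ys = refl

χ-below : ∀ {m f} t → f < m → χ [ m ] (f ∷ t) ≡ 1
χ-below t f<m rewrite <⇒<ᵇ≡true f<m = refl

χ-above : ∀ {m f} t → m ≤ f → χ [ m ] (f ∷ t) ≡ 0
χ-above t m≤f rewrite ≥⇒<ᵇ≡false m≤f = refl

χ-≤-1 : ∀ m r → χ [ m ] r ≤ 1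
χ-≤-1 m []      = z≤n
χ-≤-1 m (f ∷ t) with f <ᵇ m
... | true  = ≤-refl
... | false = z≤n

des-++ : ∀ u v → des (u ++ v) ≡ des u + χ u v + des v
des-++ []           []      = refl
des-++ []           (y ∷ v) = refl
des-++ (a ∷ [])     []      = refl
des-++ (a ∷ [])     (y ∷ v) = refl
des-++ (a ∷ b ∷ xs) v = begin
  [b<a] + des (b ∷ xs ++ v)                     ≡⟨ cong ([b<a] +_) (des-++ (b ∷ xs) v) ⟩
  [b<a] + (des (b ∷ xs) + χ (b ∷ xs) v + des v) ≡⟨ +-assoc [b<a] _ _ ⟨
  [b<a] + (des (b ∷ xs) + χ (b ∷ xs) v) + des v ≡⟨ cong (_+ des v) (+-assoc [b<a] _ _) ⟨
  [b<a] + des (b ∷ xs) + χ (b ∷ xs) v + des v   ≡⟨ cong (λ c → des (a ∷ b ∷ xs) + c + des v) (χ-∷∷ v) ⟩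
  des (a ∷ b ∷ xs) + χ (a ∷ b ∷ xs) v + des v   ∎
  where
  open ≡-Reasoning
  [b<a] = if b <ᵇ a then 1 else 0
  χ-∷∷ : ∀ v → χ (b ∷ xs) v ≡ χ (a ∷ b ∷ xs) v
  χ-∷∷ []      = refl
  χ-∷∷ (_ ∷ _) = refl

des-++-∷ : ∀ xs z ys → des (xs ++ z ∷ ys) ≡ des (xs ++ [ z ]) + des (z ∷ ys)
des-++-∷ xs z ys = begin
  des (xs ++ z ∷ ys)                              ≡⟨ cong des (++-assoc xs [ z ] ys) ⟨
  des ((xs ++ [ z ]) ++ ys)                       ≡⟨ des-++ (xs ++ [ z ]) ys ⟩
  des (xs ++ [ z ]) + χ (xs ++ [ z ]) ys + des ys ≡⟨ cong (λ c → des (xs ++ [ z ]) + c + des ys) (χ-++-∷ xs z [] ys) ⟩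
  des (xs ++ [ z ]) + χ [ z ] ys + des ys         ≡⟨ +-assoc (des (xs ++ [ z ])) _ _ ⟩
  des (xs ++ [ z ]) + (χ [ z ] ys + des ys)       ≡⟨ cong (des (xs ++ [ z ]) +_) (des-++ [ z ] ys) ⟨
  des (xs ++ [ z ]) + des (z ∷ ys)                ∎
  where open ≡-Reasoning

des-sorted : ∀ {w} → Sorted w → des w ≡ 0
des-sorted []      = refl
des-sorted [-]     = refl
des-sorted {x ∷ y ∷ _} (x≤y ∷ s) rewrite ≥⇒<ᵇ≡false x≤y = des-sorted s

des-decreasing : ∀ {z w} → Linked _>_ (z ∷ w) → des (z ∷ w) ≡ length w
des-decreasing [-]       = refl
des-decreasing (z>y ∷ l) rewrite <⇒<ᵇ≡true z>y = cong suc (des-decreasing l)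

inv-strict : ∀ {xs} → AllPairs _<_ xs → inv xs ≡ 0
inv-strict [] = refl
inv-strict {x ∷ xs} (x<xs ∷ ap) rewrite filter-none (_<? x) (All.map <⇒≯ x<xs) = inv-strict ap

inv-pull-front : ∀ pre x post → AllPairs _<_ (pre ++ x ∷ post) → inv (x ∷ pre ++ post) ≡ length pre
inv-pull-front pre x post ap with AllPairs-++⁻ pre ap
... | _ , x<post ∷ _ , cross = begin
  length (filter (_<? x) (pre ++ post)) + inv (pre ++ post)
    ≡⟨ cong₂ _+_ (cong length (filter-++ (_<? x) pre post)) (inv-strict (AllPairs-delete pre ap)) ⟩
  length (filter (_<? x) pre ++ filter (_<? x) post) + 0
    ≡⟨ cong (λ v → length v + 0) (cong₂ _++_ (filter-all (_<? x) pre<x)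
                                              (filter-none (_<? x) (All.map <⇒≯ x<post))) ⟩
  length (pre ++ []) + 0
    ≡⟨ trans (+-identityʳ _) (cong length (++-identityʳ pre)) ⟩
  length pre ∎
  where
  open ≡-Reasoning
  pre<x = All.map All.head cross

srwDec-++ : ∀ p c w → uncurry _++_ (srwDec p c w) ≡ w
srwDec-++ p c [] = refl
srwDec-++ p c (y ∷ ys) with y <ᵇ c | p <ᵇ y
... | true  | true  = cong (y ∷_) (srwDec-++ p y ys)
... | true  | false = refl
... | false | _     = refl

srwStep-++ : ∀ p x w → uncurry _++_ (srwStep p x w) ≡ x ∷ w
srwStep-++ p x [] = refl
srwStep-++ p x (y ∷ ys) = if-elim (λ (r : Word × Word) → uncurry _++_ r ≡ x ∷ y ∷ ys) (y <ᵇ x)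
  (λ _ → cong (x ∷_) (srwDec-++ p x (y ∷ ys)))
  (λ _ → cong (x ∷_) (srwStep-++ x y ys))

srw-++-srwRest : ∀ w → srw w ++ srwRest w ≡ w
srw-++-srwRest [] = refl
srw-++-srwRest (x ∷ xs) = srwStep-++ 0 x xs

srwDec-rest-≤ : ∀ p c w → length (proj₂ (srwDec p c w)) ≤ length w
srwDec-rest-≤ p c [] = ≤-refl
srwDec-rest-≤ p c (y ∷ ys) with y <ᵇ c | p <ᵇ y
... | true  | true  = m≤n⇒m≤1+n (srwDec-rest-≤ p y ys)
... | true  | false = ≤-refl
... | false | _     = ≤-refl

srwStep-rest-≤ : ∀ p x w → length (proj₂ (srwStep p x w)) ≤ length w
srwStep-rest-≤ p x [] = z≤n
srwStep-rest-≤ p x (y ∷ ys) = if-elim (λ (r : Word × Word) → length (proj₂ r) ≤ length (y ∷ ys)) (y <ᵇ x)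
  (λ _ → srwDec-rest-≤ p x (y ∷ ys))
  (λ _ → m≤n⇒m≤1+n (srwStep-rest-≤ x y ys))

srwRest-shorter : ∀ x xs → length (srwRest (x ∷ xs)) < length (x ∷ xs)
srwRest-shorter x xs = s≤s (srwStep-rest-≤ 0 x xs)

srw-induction : (P : Word → Set) → P [] → (∀ x xs → P (srwRest (x ∷ xs)) → P (x ∷ xs)) → ∀ w → P w
srw-induction P base step w = go (length w) w ≤-refl
  where
  go : ∀ n w → length w ≤ n → P w
  go _       []       _         = base
  go (suc n) (x ∷ xs) (s≤s |xs|≤n) =
    step x xs (go n _ (≤-trans (≤-pred (srwRest-shorter x xs)) |xs|≤n))

θ-fuel-irrelevant : ∀ m n w → length w ≤ m → length w ≤ n → θ-fuel m w ≡ θ-fuel n w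
θ-fuel-irrelevant zero    zero    []       _ _ = refl
θ-fuel-irrelevant zero    (suc n) []       _ _ = refl
θ-fuel-irrelevant (suc m) zero    []       _ _ = refl
θ-fuel-irrelevant (suc m) (suc n) []       _ _ = refl
θ-fuel-irrelevant (suc m) (suc n) (x ∷ xs) (s≤s |xs|≤m) (s≤s |xs|≤n) =
  cong (_++ δ (srdes (x ∷ xs)) (srw (x ∷ xs)))
    (θ-fuel-irrelevant m n _ (≤-trans shorter |xs|≤m) (≤-trans shorter |xs|≤n))
  where shorter = ≤-pred (srwRest-shorter x xs)

θ-unfold : ∀ x xs → θ (x ∷ xs) ≡ θ (srwRest (x ∷ xs)) ++ δ (srdes (x ∷ xs)) (srw (x ∷ xs))
θ-unfold x xs = cong (_++ δ (srdes (x ∷ xs)) (srw (x ∷ xs)))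
  (θ-fuel-irrelevant (length xs) _ _ (≤-pred (srwRest-shorter x xs)) ≤-refl)

des-srw : ∀ w → des w ≡ srdes w + des (srwRest w)
des-srw w = begin
  des w                     ≡⟨ cong des (srw-++-srwRest w) ⟨
  des (srw w ++ srwRest w)  ≡⟨ des-++ (srw w) (srwRest w) ⟩
  srdes w + des (srwRest w) ∎
  where open ≡-Reasoning

InW-srw : ∀ w → InW w → InW (srw w) × InW (srwRest w)
InW-srw w iw = InW-++⁻ (srw w) (subst InW (sym (srw-++-srwRest w)) iw)

-- Hooks and lec

data Hook : Word → Set where
  hook : ∀ {a b t} → b < a → Sorted (b ∷ t) → Hook (a ∷ b ∷ t)

inv-hook-positive : ∀ {h} → Hook h → 1 ≤ inv h
inv-hook-positive (hook {a} {b} {t} b<a _) rewrite filter-accept (_<? a) {xs = t} b<a = s≤s z≤n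

data HookFactorization : Word → Set where
  initial : ∀ {γ} → Sorted γ → HookFactorization γ
  _⊳_     : ∀ {p h} → HookFactorization p → Hook h → HookFactorization (p ++ h)

infixl 5 _⊳_

cons-increasing : ∀ x {γ} → Sorted γ → HookFactorization (x ∷ γ)
cons-increasing x {[]}     _ = initial [-]
cons-increasing x {y ∷ ys} s with y <? x
... | yes y<x = initial [] ⊳ hook y<x s
... | no  y≮x = initial (≮⇒≥ y≮x ∷ s)

cons-factorization : ∀ x {w} → HookFactorization w → HookFactorization (x ∷ w)
cons-factorization x (initial s) = cons-increasing x s
cons-factorization x (f ⊳ h)     = cons-factorization x f ⊳ h

hookFactorization : ∀ w → HookFactorization w
hookFactorization []       = initial []
hookFactorization (x ∷ xs) = cons-factorization x (hookFactorization xs)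

lastHook-skip : ∀ ls run r → Sorted (reverse ls ++ run) →
                lastHook run (ls ++ r) ≡ lastHook (reverse ls ++ run) r
lastHook-skip []       run r _ = refl
lastHook-skip (x ∷ ls) [] r s =
  trans (lastHook-skip ls (x ∷ []) r (subst Sorted (reverse-∷-++ x ls []) s))
        (cong (λ v → lastHook v r) (sym (reverse-∷-++ x ls [])))
lastHook-skip (x ∷ ls) (c ∷ run) r s with c <ᵇ x in c<ᵇx
... | true  = ⊥-elim (<⇒≱ (<ᵇ≡true⇒< c<ᵇx)
                (Linked.head (Linked-++⁻ʳ (reverse ls) (subst Sorted (reverse-∷-++ x ls (c ∷ run)) s))))
... | false =
  trans (lastHook-skip ls (x ∷ c ∷ run) r (subst Sorted (reverse-∷-++ x ls (c ∷ run)) s))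
        (cong (λ v → lastHook v r) (sym (reverse-∷-++ x ls (c ∷ run))))

reverse-reverse-++ : ∀ (w : Word) → reverse (reverse w) ++ [] ≡ w
reverse-reverse-++ w = trans (++-identityʳ _) (reverse-involutive w)

lastHook-sorted : ∀ w → Sorted w → lastHook [] (reverse w) ≡ nothing
lastHook-sorted w s = begin
  lastHook [] (reverse w)                 ≡⟨ cong (lastHook []) (++-identityʳ (reverse w)) ⟨
  lastHook [] (reverse w ++ [])           ≡⟨ lastHook-skip (reverse w) [] [] s′ ⟩
  lastHook (reverse (reverse w) ++ []) [] ≡⟨⟩
  nothing                                 ∎
  where
  open ≡-Reasoning
  s′ = subst Sorted (sym (reverse-reverse-++ w)) s

lastHook-hook : ∀ {h} r → Hook h → lastHook [] (reverse h ++ r) ≡ just (h , r)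
lastHook-hook r (hook {a} {b} {t} b<a s) = begin
  lastHook [] (reverse (a ∷ b ∷ t) ++ r)             ≡⟨ cong (lastHook []) (reverse-∷-++ a (b ∷ t) r) ⟩
  lastHook [] (reverse (b ∷ t) ++ a ∷ r)             ≡⟨ lastHook-skip (reverse (b ∷ t)) [] (a ∷ r) s′ ⟩
  lastHook (reverse (reverse (b ∷ t)) ++ []) (a ∷ r) ≡⟨ cong (λ v → lastHook v (a ∷ r)) (reverse-reverse-++ (b ∷ t)) ⟩
  lastHook (b ∷ t) (a ∷ r)                           ≡⟨ descent ⟩
  just (a ∷ b ∷ t , r)                               ∎
  where
  open ≡-Reasoning
  descent : lastHook (b ∷ t) (a ∷ r) ≡ just (a ∷ b ∷ t , r)
  descent rewrite <⇒<ᵇ≡true b<a = refl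
  s′ = subst Sorted (sym (reverse-reverse-++ (b ∷ t))) s

lastHook-shorter : ∀ run r {h r′} → lastHook run r ≡ just (h , r′) → length r′ < length r
lastHook-shorter run      []       ()
lastHook-shorter []       (x ∷ xs) e = m≤n⇒m≤1+n (lastHook-shorter (x ∷ []) xs e)
lastHook-shorter (c ∷ run) (x ∷ xs) e with c <ᵇ x
lastHook-shorter (c ∷ run) (x ∷ xs) refl | true = ≤-refl
... | false = m≤n⇒m≤1+n (lastHook-shorter (x ∷ c ∷ run) xs e)

hooksRev-fuel-irrelevant : ∀ m n r → length r ≤ m → length r ≤ n → hooksRev m r ≡ hooksRev n r
hooksRev-fuel-irrelevant zero    zero    r  _ _ = refl
hooksRev-fuel-irrelevant zero    (suc n) [] _ _ = refl
hooksRev-fuel-irrelevant (suc m) zero    [] _ _ = refl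
hooksRev-fuel-irrelevant (suc m) (suc n) r  r≤m r≤n with lastHook [] r in e
... | nothing       = refl
... | just (h , r′) = cong (_∷ʳ h) (hooksRev-fuel-irrelevant m n r′
                        (≤-pred (≤-trans (lastHook-shorter [] r e) r≤m))
                        (≤-pred (≤-trans (lastHook-shorter [] r e) r≤n)))

hooks-sorted : ∀ w → Sorted w → hooks w ≡ []
hooks-sorted w s with length w
... | zero  = refl
... | suc n rewrite lastHook-sorted w s = refl

hooks-++-hook : ∀ p {h} → Hook h → hooks (p ++ h) ≡ hooks p ∷ʳ h
hooks-++-hook p {h@(a ∷ b ∷ t)} hk = begin
  hooksRev (length (p ++ h)) (reverse (p ++ h)) ≡⟨ cong₂ hooksRev (length-++-sucʳ p a (b ∷ t)) (reverse-++ p h) ⟩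
  hooksRev (suc n) (reverse h ++ reverse p)     ≡⟨ hooksRev-hook ⟩
  hooksRev n (reverse p) ∷ʳ h                   ≡⟨ cong (_∷ʳ h) (hooksRev-fuel-irrelevant n _ _ |p|≤n |p|≤|p|) ⟩
  hooks p ∷ʳ h                                  ∎
  where
  open ≡-Reasoning
  n = length (p ++ b ∷ t)
  |p|≤n : length (reverse p) ≤ n
  |p|≤n = ≤-trans (≤-reflexive (length-reverse p)) (length-++-≤ˡ p)
  |p|≤|p| = ≤-reflexive (length-reverse p)
  hooksRev-hook : hooksRev (suc n) (reverse h ++ reverse p) ≡ hooksRev n (reverse p) ∷ʳ h
  hooksRev-hook rewrite lastHook-hook (reverse p) hk = refl

lec-sorted : ∀ w → Sorted w → lec w ≡ 0
lec-sorted w s = cong (sum ∘ map inv) (hooks-sorted w s)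

lec-++-hook : ∀ p {h} → Hook h → lec (p ++ h) ≡ lec p + inv h
lec-++-hook p {h} hk = begin
  sum (map inv (hooks (p ++ h)))        ≡⟨ cong (sum ∘ map inv) (hooks-++-hook p hk) ⟩
  sum (map inv (hooks p ∷ʳ h))          ≡⟨ cong sum (map-++ inv (hooks p) (h ∷ [])) ⟩
  sum (map inv (hooks p) ++ inv h ∷ []) ≡⟨ sum-++ (map inv (hooks p)) (inv h ∷ []) ⟩
  lec p + (inv h + 0)                   ≡⟨ cong (lec p +_) (+-identityʳ (inv h)) ⟩
  lec p + inv h                         ∎
  where open ≡-Reasoning

hook-suffix-unique : ∀ {p₁ p₂ h₁ h₂} → p₁ ++ h₁ ≡ p₂ ++ h₂ → Hook h₁ → Hook h₂ →
                     p₁ ≡ p₂ × h₁ ≡ h₂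
hook-suffix-unique {p₁} {p₂} {h₁} {h₂} e hk₁ hk₂ =
  reverse-injective (cong proj₂ same) , cong proj₁ same
  where
  same : (h₁ , reverse p₁) ≡ (h₂ , reverse p₂)
  same = just-injective (begin
    just (h₁ , reverse p₁)                 ≡⟨ lastHook-hook (reverse p₁) hk₁ ⟨
    lastHook [] (reverse h₁ ++ reverse p₁) ≡⟨ cong (lastHook []) (reverse-++ p₁ h₁) ⟨
    lastHook [] (reverse (p₁ ++ h₁))       ≡⟨ cong (lastHook [] ∘ reverse) e ⟩
    lastHook [] (reverse (p₂ ++ h₂))       ≡⟨ cong (lastHook []) (reverse-++ p₂ h₂) ⟩
    lastHook [] (reverse h₂ ++ reverse p₂) ≡⟨ lastHook-hook (reverse p₂) hk₂ ⟩
    just (h₂ , reverse p₂)                 ∎)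
    where open ≡-Reasoning

hook-normal-form : ∀ {h} → Hook h → Unique h →
                   ∃ λ pre → ∃ λ a → ∃ λ post →
                   h ≡ a ∷ pre ++ post × AllPairs _<_ (pre ++ a ∷ post) × 1 ≤ length pre
hook-normal-form (hook {a} {b} {t} b<a s) (a≢bt ∷ uq) with span-around a s a≢bt
... | [] , _ , refl , _ , a<b ∷ _ = ⊥-elim (<-asym a<b b<a)
... | pre@(_ ∷ _) , post , e , pre<a , a<post =
  pre , a , post , cong (a ∷_) e ,
  AllPairs-insert pre (subst (AllPairs _<_) e (strictly-sorted s uq)) pre<a a<post , s≤s z≤n

δ-↭ : ∀ d u → δ d u ↭ u
δ-↭ d u with splitAt d (sort u) in eq
... | pre , []       = begin
  pre       ≡⟨ ++-identityʳ pre ⟨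
  pre ++ [] ≡⟨ splitAt-++ d _ eq ⟩
  sort u    ↭⟨ sort-↭ u ⟩
  u         ∎
  where open PermutationReasoning
... | pre , x ∷ post = begin
  x ∷ pre ++ post ↭⟨ ↭.shift x pre post ⟨
  pre ++ x ∷ post ≡⟨ splitAt-++ d _ eq ⟩
  sort u          ↭⟨ sort-↭ u ⟩
  u               ∎
  where open PermutationReasoning

δ-at : ∀ u pre x post → sort u ≡ pre ++ x ∷ post → δ (length pre) u ≡ x ∷ pre ++ post
δ-at u pre x post e with sort u
δ-at u pre x post refl | _ rewrite splitAt-length pre (x ∷ post) = refl

δ-zero : ∀ u → δ 0 u ≡ sort u
δ-zero u with sort u
... | []    = refl
... | _ ∷ _ = refl

δ≡δ⇒sort≡ : ∀ d₁ d₂ u₁ u₂ → δ d₁ u₁ ≡ δ d₂ u₂ → sort u₁ ≡ sort u₂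
δ≡δ⇒sort≡ d₁ d₂ u₁ u₂ e =
  ↭⇒sort≡ (↭-trans (↭-sym (δ-↭ d₁ u₁)) (subst (_↭ u₂) (sym e) (δ-↭ d₂ u₂)))

θ-↭ : ∀ w → θ w ↭ w
θ-↭ = srw-induction (λ w → θ w ↭ w) ↭-refl λ x xs ih → begin
  θ (x ∷ xs)                                                ≡⟨ θ-unfold x xs ⟩
  θ (srwRest (x ∷ xs)) ++ δ (srdes (x ∷ xs)) (srw (x ∷ xs)) ↭⟨ ↭.++⁺ ih (δ-↭ (srdes (x ∷ xs)) _) ⟩
  srwRest (x ∷ xs) ++ srw (x ∷ xs)                          ↭⟨ ↭.++-comm (srwRest (x ∷ xs)) _ ⟩
  srw (x ∷ xs) ++ srwRest (x ∷ xs)                          ≡⟨ srw-++-srwRest (x ∷ xs) ⟩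
  x ∷ xs                                                    ∎
  where open PermutationReasoning

δ-hook : ∀ {d u} → 1 ≤ d → d < length u → Unique u → Hook (δ d u) × inv (δ d u) ≡ d
δ-hook {d} {u} 1≤d d<|u| unique with split-at-index d (sort u) (subst (d <_) (↭.↭-length (↭-sym (sort-↭ u))) d<|u|)
... | pre , x , post , eq , refl = subst (λ h → Hook h × inv h ≡ length pre) (sym (δ-at u pre x post eq))
  (hook′ pre 1≤d strict , inv-pull-front pre x post strict)
  where
  strict : AllPairs _<_ (pre ++ x ∷ post)
  strict = subst (AllPairs _<_) eq
    (strictly-sorted (sort-↗ u) (PermSetoid.Unique-resp-↭ (setoid ℕ) (↭⇒↭ₛ (↭-sym (sort-↭ u))) unique))
  hook′ : ∀ pre → 1 ≤ length pre → AllPairs _<_ (pre ++ x ∷ post) → Hook (x ∷ pre ++ post)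
  hook′ (b ∷ pre) _ ap with AllPairs-++⁻ (b ∷ pre) ap
  ... | _ , _ , (b<x ∷ _) ∷ _ = hook b<x (strict⇒sorted (AllPairs-delete (b ∷ pre) ap))

-- The shape of the special reverse wave

data DecStop (q m : ℕ) : Word → Set where
  end    : DecStop q m []
  ascent : ∀ {f t} → m ≤ f → DecStop q m (f ∷ t)
  low    : ∀ {f t} → f ≤ q → DecStop q m (f ∷ t)

record DescendingRun (q c : ℕ) (run rest : Word) : Set where
  constructor descendingRun
  field
    decreasing : Linked _>_ (c ∷ run)
    above      : All (q <_) run
    stops      : DecStop q (lastOr c run) rest

srwDec-run : ∀ q c ws → uncurry (DescendingRun q c) (srwDec q c ws)
srwDec-run q c [] = descendingRun [-] [] end
srwDec-run q c (y ∷ ys) with y <ᵇ c in y<ᵇc | q <ᵇ y in q<ᵇy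
... | true  | true  = descendingRun (<ᵇ≡true⇒< y<ᵇc ∷ decreasing) (<ᵇ≡true⇒< q<ᵇy ∷ above) stops
  where open DescendingRun (srwDec-run q y ys)
... | true  | false = descendingRun [-] [] (low (<ᵇ≡false⇒≥ q<ᵇy))
... | false | _     = descendingRun [-] [] (ascent (<ᵇ≡false⇒≥ y<ᵇc))

run-srwDec : ∀ {q c run rest} → DescendingRun q c run rest → srwDec q c (run ++ rest) ≡ (run , rest)
run-srwDec (descendingRun [-] [] end) = refl
run-srwDec (descendingRun [-] [] (ascent c≤f)) rewrite ≥⇒<ᵇ≡false c≤f = refl
run-srwDec {q} {c} (descendingRun [-] [] (low {f} f≤q)) with f <ᵇ c
... | true rewrite ≥⇒<ᵇ≡false f≤q = refl
... | false = refl
run-srwDec (descendingRun (c>d ∷ l) (q<d ∷ above) stops) rewrite <⇒<ᵇ≡true c>d | <⇒<ᵇ≡true q<d =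
  cong (map₁ (_ ∷_)) (run-srwDec (descendingRun l above stops))

-- Why a descending run with last letter m and k letters after its top stops, w_{t-1} being q:
-- the word ends, the next letter descends to at most q, or (k ≥ 1) it is an ascent.
data Stop (q m k : ℕ) : Word → Set where
  end    : Stop q m k []
  low    : ∀ {f t} → f < m → f ≤ q → Stop q m k (f ∷ t)
  ascent : ∀ {f t} → 1 ≤ k → m ≤ f → Stop q m k (f ∷ t)

decStop⇒stop : ∀ {q x y run rest} → y < x → head (run ++ rest) ≡ just y → All (q <_) run →
               DecStop q (lastOr x run) rest → Stop q (lastOr x run) (length run) rest
decStop⇒stop _ _ _ end = end
decStop⇒stop {run = []}    y<x refl _ (ascent x≤y) = ⊥-elim (<⇒≱ y<x x≤y)
decStop⇒stop {run = _ ∷ _} _   _    _ (ascent le)  = ascent (s≤s z≤n) le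
decStop⇒stop {run = []}    y<x refl _ (low y≤q)    = low y<x y≤q
decStop⇒stop {run = d ∷ run} _ _ (q<d ∷ above) (low f≤q) =
  low (≤-<-trans f≤q (All-lastOr d run q<d above)) f≤q

stop⇒decStop : ∀ {q m k rest} → Stop q m k rest → DecStop q m rest
stop⇒decStop end            = end
stop⇒decStop (low _ f≤q)    = low f≤q
stop⇒decStop (ascent _ m≤f) = ascent m≤f

-- u = inc ++ top ∷ dec followed by r: inc ++ [ top ] rises up to the first descent and top ∷ dec
-- falls while staying above w_{t-1} = lastOr p inc, where p stands for the letter before u (w₀ = 0).
record Wave (p : ℕ) (u r : Word) : Set where
  field
    inc        : Word
    top        : ℕ
    dec        : Word
    split      : u ≡ inc ++ top ∷ dec
    increasing : Sorted (inc ++ [ top ])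
    decreasing : Linked _>_ (top ∷ dec)
    above      : All (lastOr p inc <_) dec
    stops      : Stop (lastOr p inc) (lastOr top dec) (length dec) r

srwStep-head : ∀ p x ys → head (proj₁ (srwStep p x ys)) ≡ just x
srwStep-head p x []       = refl
srwStep-head p x (y ∷ ys) =
  if-elim (λ (r : Word × Word) → head (proj₁ r) ≡ just x) (y <ᵇ x) (λ _ → refl) (λ _ → refl)

srwStep-wave : ∀ p x ys → uncurry (Wave p) (srwStep p x ys)
srwStep-wave p x [] = record
  { inc = [] ; top = x ; dec = [] ; split = refl
  ; increasing = [-] ; decreasing = [-] ; above = [] ; stops = end }
srwStep-wave p x (y ∷ ys) = if-elim (uncurry (Wave p)) (y <ᵇ x) descending ascending
  where
  D = srwDec p x (y ∷ ys)
  descending : (y <ᵇ x) ≡ true → Wave p (x ∷ proj₁ D) (proj₂ D)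
  descending y<ᵇx = record
    { inc = [] ; top = x ; dec = proj₁ D ; split = refl
    ; increasing = [-] ; decreasing = decreasing ; above = above
    ; stops = decStop⇒stop (<ᵇ≡true⇒< y<ᵇx) (cong head (srwDec-++ p x (y ∷ ys))) above stops }
    where open DescendingRun (srwDec-run p x (y ∷ ys))
  A = srwStep x y ys
  ascending : (y <ᵇ x) ≡ false → Wave p (x ∷ proj₁ A) (proj₂ A)
  ascending y<ᵇx≡false = record
    { inc = x ∷ inc ; top = top ; dec = dec ; split = cong (x ∷_) split
    ; increasing = subst (Connected _≤_ (just x)) head-y (just (<ᵇ≡false⇒≥ y<ᵇx≡false)) ∷′ increasing
    ; decreasing = decreasing ; above = above ; stops = stops }
    where
    open Wave (srwStep-wave x y ys)
    head-y : just y ≡ head (inc ++ [ top ])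
    head-y = sym (trans (head-++-∷ inc [] dec) (trans (cong head (sym split)) (srwStep-head x y ys)))

descend-srwStep : ∀ {q z dec r} → Linked _>_ (z ∷ dec) → All (q <_) dec → Stop q (lastOr z dec) (length dec) r →
                  srwStep q z (dec ++ r) ≡ (z ∷ dec , r)
descend-srwStep {dec = []} [-] [] end = refl
descend-srwStep {dec = []} [-] [] (low f<z f≤q) rewrite <⇒<ᵇ≡true f<z | ≥⇒<ᵇ≡false f≤q = refl
descend-srwStep {dec = []} [-] [] (ascent () _)
descend-srwStep {z = z} {dec = d ∷ dec} (z>d ∷ l) above st = trans (if-true (<⇒<ᵇ≡true z>d))
  (cong (map₁ (z ∷_)) (run-srwDec (descendingRun (z>d ∷ l) above (stop⇒decStop st))))

ascend-srwStep : ∀ p i inc z rest → Sorted (i ∷ inc ++ [ z ]) →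
                 srwStep p i (inc ++ z ∷ rest) ≡ map₁ (λ u → i ∷ inc ++ u) (srwStep (lastOr i inc) z rest)
ascend-srwStep p i []        z rest (i≤z ∷ _) rewrite ≥⇒<ᵇ≡false i≤z = refl
ascend-srwStep p i (j ∷ inc) z rest (i≤j ∷ s) rewrite ≥⇒<ᵇ≡false i≤j =
  cong (map₁ (i ∷_)) (ascend-srwStep i j inc z rest s)

srwSplit-wave : ∀ {u r} → Wave 0 u r → srwSplit (u ++ r) ≡ (u , r)
srwSplit-wave record { inc = [] ; split = refl ; decreasing = d ; above = a ; stops = s } =
  descend-srwStep d a s
srwSplit-wave {r = r} record { inc = i ∷ inc ; top = top ; dec = dec ; split = refl
                             ; increasing = si ; decreasing = d ; above = a ; stops = s } = begin
  srwStep 0 i ((inc ++ top ∷ dec) ++ r)                 ≡⟨ cong (srwStep 0 i) (++-assoc inc (top ∷ dec) r) ⟩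
  srwStep 0 i (inc ++ top ∷ dec ++ r)                   ≡⟨ ascend-srwStep 0 i inc top (dec ++ r) si ⟩
  map₁ prefix (srwStep (lastOr i inc) top (dec ++ r))   ≡⟨ cong (map₁ prefix) (descend-srwStep d a s) ⟩
  (i ∷ inc ++ top ∷ dec , r)                            ∎
  where
  open ≡-Reasoning
  prefix = λ v → i ∷ inc ++ v

wave : ∀ x xs → Wave 0 (srw (x ∷ xs)) (srwRest (x ∷ xs))
wave x xs = srwStep-wave 0 x xs

lastOr0-positive : ∀ inc → 1 ≤ lastOr 0 inc → 1 ≤ length inc
lastOr0-positive (_ ∷ _) _ = s≤s z≤n

module _ {p u r} (W : Wave p u r) where
  open Wave W

  des-wave : des u ≡ length dec
  des-wave = begin
    des u                                  ≡⟨ cong des split ⟩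
    des (inc ++ top ∷ dec)                 ≡⟨ des-++-∷ inc top dec ⟩
    des (inc ++ [ top ]) + des (top ∷ dec) ≡⟨ cong₂ _+_ (des-sorted increasing) (des-decreasing decreasing) ⟩
    length dec                             ∎
    where open ≡-Reasoning

  χ-wave : χ u r ≡ χ [ lastOr top dec ] r
  χ-wave = trans (cong (λ v → χ v r) split) (χ-++-∷ inc top dec r)

  sort-wave : sort u ≡ inc ++ reverse (top ∷ dec)
  sort-wave = ↗↭↗⇒≡ (sort-↗ u) sorted (begin
    sort u                     ↭⟨ sort-↭ u ⟩
    u                          ≡⟨ split ⟩
    inc ++ top ∷ dec           ↭⟨ ↭.++⁺ˡ inc (↭.↭-reverse (top ∷ dec)) ⟨
    inc ++ reverse (top ∷ dec) ∎)
    where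
    open PermutationReasoning
    sorted : Sorted (inc ++ reverse (top ∷ dec))
    sorted = subst (λ v → Sorted (inc ++ v)) (trans (sym (reverse-∷-++ top dec [])) (++-identityʳ _))
               (Sorted-++-reverse p inc top dec decreasing above increasing)

  wave-ends : χ [ lastOr top dec ] r ≡ 0 → length dec ≡ 0 → r ≡ []
  wave-ends χ≡0 k≡0 with stops
  ... | end               = refl
  ... | low {t = t} f<m _ = ⊥-elim (0≢1+n (trans (sym χ≡0) (χ-below t f<m)))
  ... | ascent 1≤k _      = ⊥-elim (<⇒≢ 1≤k (sym k≡0))

module _ {u r} (W : Wave 0 u r) where
  open Wave W

  -- A stop below w_{t-1} needs a letter before the run, since w₀ = 0 is below every letter.
  χ-wave-≤-inc : All (1 ≤_) r → χ [ lastOr top dec ] r ≤ length inc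
  χ-wave-≤-inc positive with stops
  ... | end                      = z≤n
  ... | low    {t = t} f<m f≤q rewrite χ-below t f<m = lastOr0-positive inc (≤-trans (All.head positive) f≤q)
  ... | ascent {t = t} _   m≤f rewrite χ-above t m≤f = z≤n

module _ (x : ℕ) (xs : Word) where
  open Wave (wave x xs)

  srdes-wave : srdes (x ∷ xs) ≡ length dec + χ [ lastOr top dec ] (srwRest (x ∷ xs))
  srdes-wave = cong₂ _+_ (des-wave (wave x xs)) (χ-wave (wave x xs))

  srdes<length-srw : All (1 ≤_) (srwRest (x ∷ xs)) → srdes (x ∷ xs) < length (srw (x ∷ xs))
  srdes<length-srw positive = begin-strict
    srdes (x ∷ xs)                                       ≡⟨ srdes-wave ⟩
    length dec + χ [ lastOr top dec ] (srwRest (x ∷ xs)) ≤⟨ +-monoʳ-≤ (length dec) (χ-wave-≤-inc (wave x xs) positive) ⟩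
    length dec + length inc                              ≡⟨ +-comm (length dec) (length inc) ⟩
    length inc + length dec                              <⟨ ≤-reflexive (sym (+-suc (length inc) (length dec))) ⟩
    length inc + length (top ∷ dec)                      ≡⟨ length-++ inc ⟨
    length (inc ++ top ∷ dec)                            ≡⟨ cong length split ⟨
    length (srw (x ∷ xs))                                ∎
    where open ≤-Reasoning

  srw≡w : srwRest (x ∷ xs) ≡ [] → srw (x ∷ xs) ≡ x ∷ xs
  srw≡w rest≡[] =
    trans (sym (++-identityʳ _)) (trans (cong (srw (x ∷ xs) ++_) (sym rest≡[])) (srw-++-srwRest (x ∷ xs)))

  whole-sorted : srdes (x ∷ xs) ≡ 0 → srwRest (x ∷ xs) ≡ [] → Sorted (x ∷ xs)
  whole-sorted srdes≡0 rest≡[] with dec | split | m+n≡0⇒m≡0 (length dec) (trans (sym srdes-wave) srdes≡0)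
  ... | [] | srw≡ | _ = subst Sorted (trans (sym srw≡) (srw≡w rest≡[])) increasing

  θ-whole : srdes (x ∷ xs) ≡ 0 → srwRest (x ∷ xs) ≡ [] → θ (x ∷ xs) ≡ x ∷ xs
  θ-whole srdes≡0 rest≡[] = begin
    θ w                                  ≡⟨ θ-unfold x xs ⟩
    θ (srwRest w) ++ δ (srdes w) (srw w) ≡⟨ cong₂ (λ r d → θ r ++ δ d (srw w)) rest≡[] srdes≡0 ⟩
    δ 0 (srw w)                          ≡⟨ cong (δ 0) (srw≡w rest≡[]) ⟩
    δ 0 w                                ≡⟨ δ-zero w ⟩
    sort w                               ≡⟨ ↗↭↗⇒≡ (sort-↗ w) (whole-sorted srdes≡0 rest≡[]) (sort-↭ w) ⟩
    w                                    ∎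
    where
    open ≡-Reasoning
    w = x ∷ xs

data Block (w : Word) : Set where
  whole  : srdes w ≡ 0 → srwRest w ≡ [] → Block w
  hooked : Hook (δ (srdes w) (srw w)) → inv (δ (srdes w) (srw w)) ≡ srdes w → Block w

block : ∀ x xs → InW (x ∷ xs) → Block (x ∷ xs)
block x xs iw with srdes (x ∷ xs) in srdes≡
... | zero  = whole srdes≡ (wave-ends (wave x xs) (m+n≡0⇒n≡0 (length dec) e) (m+n≡0⇒m≡0 _ e))
  where
  open Wave (wave x xs)
  e = trans (sym (srdes-wave x xs)) srdes≡
... | suc _ =
  uncurry hooked (δ-hook (subst (1 ≤_) (sym srdes≡) (s≤s z≤n)) (srdes<length-srw x xs rest-positive) srw-unique)
  where
  rest-positive = proj₁ (proj₂ (InW-srw (x ∷ xs) iw))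
  srw-unique = proj₂ (proj₁ (InW-srw (x ∷ xs) iw))

hooked⇒des-positive : ∀ w → Hook (δ (srdes w) (srw w)) → inv (δ (srdes w) (srw w)) ≡ srdes w → 1 ≤ des w
hooked⇒des-positive w hk inv≡ = begin
  1                         ≤⟨ inv-hook-positive hk ⟩
  inv (δ (srdes w) (srw w)) ≡⟨ inv≡ ⟩
  srdes w                   ≤⟨ m≤m+n (srdes w) _ ⟩
  srdes w + des (srwRest w) ≡⟨ des-srw w ⟨
  des w                     ∎
  where open ≤-Reasoning

des≡lec∘θ : ∀ w → InW w → des w ≡ lec (θ w)
des≡lec∘θ = srw-induction (λ w → InW w → des w ≡ lec (θ w)) (λ _ → refl) step
  where
  step : ∀ x xs → (InW (srwRest (x ∷ xs)) → des (srwRest (x ∷ xs)) ≡ lec (θ (srwRest (x ∷ xs)))) →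
         InW (x ∷ xs) → des (x ∷ xs) ≡ lec (θ (x ∷ xs))
  step x xs ih iw with block x xs iw
  ... | whole srdes≡0 rest≡[] = begin
    des (x ∷ xs)                            ≡⟨ des-srw (x ∷ xs) ⟩
    srdes (x ∷ xs) + des (srwRest (x ∷ xs)) ≡⟨ cong₂ (λ d r → d + des r) srdes≡0 rest≡[] ⟩
    0                                       ≡⟨ lec-sorted (x ∷ xs) (whole-sorted x xs srdes≡0 rest≡[]) ⟨
    lec (x ∷ xs)                            ≡⟨ cong lec (θ-whole x xs srdes≡0 rest≡[]) ⟨
    lec (θ (x ∷ xs))                        ∎
    where open ≡-Reasoning
  ... | hooked hk inv≡ = begin
    des (x ∷ xs)           ≡⟨ des-srw (x ∷ xs) ⟩
    srdes (x ∷ xs) + des r ≡⟨ cong₂ _+_ (sym inv≡) (ih (proj₂ (InW-srw (x ∷ xs) iw))) ⟩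
    inv h + lec (θ r)      ≡⟨ +-comm (inv h) _ ⟩
    lec (θ r) + inv h      ≡⟨ lec-++-hook (θ r) hk ⟨
    lec (θ r ++ h)         ≡⟨ cong lec (θ-unfold x xs) ⟨
    lec (θ (x ∷ xs))       ∎
    where
    open ≡-Reasoning
    r = srwRest (x ∷ xs)
    h = δ (srdes (x ∷ xs)) (srw (x ∷ xs))

-- Injectivity

-- If the run stopped below w_{t-1} = q, then strictly below, since q occurs in the wave.
wave-low-strict : ∀ {u r pre q} (W : Wave 0 u r) → Unique (u ++ r) → Wave.inc W ≡ pre ++ [ q ] →
                  χ [ lastOr (Wave.top W) (Wave.dec W) ] r ≡ 1 → χ [ q ] r ≡ 1
wave-low-strict {u} {r} {pre} {q} W uq inc≡ χ≡1 with Wave.stops W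
... | end                   = χ≡1
... | ascent {t = t} _ m≤f  = ⊥-elim (0≢1+n (trans (sym (χ-above t m≤f)) χ≡1))
... | low {f} {t} _ f≤q′    = χ-below t (≤∧≢⇒< f≤q (λ f≡q → Unique-++⇒≢ u uq q∈u (here refl) (sym f≡q)))
  where
  open Wave W
  f≤q : f ≤ q
  f≤q = subst (f ≤_) (trans (cong (lastOr 0) inc≡) (lastOr-++-∷ 0 pre q)) f≤q′
  q∈u : q ∈ u
  q∈u = subst (q ∈_) (sym split) (∈-++⁺ˡ (subst (q ∈_) (sym inc≡) (∈-++⁺ʳ pre (here refl))))

module _ {u₁ u₂ r} (W₁ : Wave 0 u₁ r) (W₂ : Wave 0 u₂ r) (sort≡ : sort u₁ ≡ sort u₂)
         (srdes≡ : des u₁ + χ u₁ r ≡ des u₂ + χ u₂ r) where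
  private
    module W₁ = Wave W₁
    module W₂ = Wave W₂
    R₁ = reverse (W₁.top ∷ W₁.dec)
    R₂ = reverse (W₂.top ∷ W₂.dec)
    m₁ = lastOr W₁.top W₁.dec
    m₂ = lastOr W₂.top W₂.dec

    letters : W₁.inc ++ R₁ ≡ W₂.inc ++ R₂
    letters = trans (sym (sort-wave W₁)) (trans sort≡ (sort-wave W₂))

    |R| : ∀ top (dec : Word) → length (reverse (top ∷ dec)) ≡ suc (length dec)
    |R| top dec = length-reverse (top ∷ dec)

    |inc₂|≤|inc₁| : length W₁.dec ≤ length W₂.dec → length W₂.inc ≤ length W₁.inc
    |inc₂|≤|inc₁| k₁≤k₂ = +-cancelʳ-≤ (suc (length W₁.dec)) _ _ (begin
      length W₂.inc + suc (length W₁.dec) ≤⟨ +-monoʳ-≤ (length W₂.inc) (s≤s k₁≤k₂) ⟩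
      length W₂.inc + suc (length W₂.dec) ≡⟨ cong (length W₂.inc +_) (|R| W₂.top W₂.dec) ⟨
      length W₂.inc + length R₂           ≡⟨ length-++ W₂.inc ⟨
      length (W₂.inc ++ R₂)               ≡⟨ cong length letters ⟨
      length (W₁.inc ++ R₁)               ≡⟨ length-++ W₁.inc ⟩
      length W₁.inc + length R₁           ≡⟨ cong (length W₁.inc +_) (|R| W₁.top W₁.dec) ⟩
      length W₁.inc + suc (length W₁.dec) ∎)
      where open ≤-Reasoning

    count : length W₁.dec + χ [ m₁ ] r ≡ length W₂.dec + χ [ m₂ ] r
    count = trans (sym (cong₂ _+_ (des-wave W₁) (χ-wave W₁)))
                  (trans srdes≡ (cong₂ _+_ (des-wave W₂) (χ-wave W₂)))

    χ₁≡ : ∀ mid → R₂ ≡ mid ++ R₁ → χ [ m₁ ] r ≡ length mid + χ [ m₂ ] r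
    χ₁≡ mid R₂≡ = +-cancelˡ-≡ (length W₁.dec) _ _ (begin
      length W₁.dec + χ [ m₁ ] r                ≡⟨ count ⟩
      length W₂.dec + χ [ m₂ ] r                ≡⟨ cong (_+ χ [ m₂ ] r) k₂≡ ⟩
      length mid + length W₁.dec + χ [ m₂ ] r   ≡⟨ cong (_+ χ [ m₂ ] r) (+-comm (length mid) _) ⟩
      length W₁.dec + length mid + χ [ m₂ ] r   ≡⟨ +-assoc (length W₁.dec) _ _ ⟩
      length W₁.dec + (length mid + χ [ m₂ ] r) ∎)
      where
      open ≡-Reasoning
      k₂≡ : length W₂.dec ≡ length mid + length W₁.dec
      k₂≡ = suc-injective (begin
        suc (length W₂.dec)              ≡⟨ |R| W₂.top W₂.dec ⟨
        length R₂                        ≡⟨ cong length R₂≡ ⟩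
        length (mid ++ R₁)               ≡⟨ length-++ mid ⟩
        length mid + length R₁           ≡⟨ cong (length mid +_) (|R| W₁.top W₁.dec) ⟩
        length mid + suc (length W₁.dec) ≡⟨ +-suc (length mid) _ ⟩
        suc (length mid + length W₁.dec) ∎)

  -- The letters fix the wave once the length of its run is known.  If the second run has one more
  -- letter q, then χ = 1 for the first wave and χ = 0 for the second, which wave-low-strict forbids.
  wave-unique-≤ : Unique (u₁ ++ r) → length W₁.dec ≤ length W₂.dec → u₁ ≡ u₂
  wave-unique-≤ uq k₁≤k₂ with ++-≡-++ W₁.inc R₁ W₂.inc R₂ letters (|inc₂|≤|inc₁| k₁≤k₂)
  ... | [] , inc₁≡ , R₂≡ = begin
    u₁                        ≡⟨ W₁.split ⟩
    W₁.inc ++ W₁.top ∷ W₁.dec ≡⟨ cong₂ _++_ (trans inc₁≡ (++-identityʳ W₂.inc)) (reverse-injective (sym R₂≡)) ⟩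
    W₂.inc ++ W₂.top ∷ W₂.dec ≡⟨ W₂.split ⟨
    u₂                        ∎
    where open ≡-Reasoning
  ... | q ∷ [] , inc₁≡ , R₂≡ = ⊥-elim (0≢1+n (begin
    0          ≡⟨ c₂≡0 ⟨
    χ [ m₂ ] r ≡⟨ cong (λ m → χ [ m ] r) m₂≡q ⟩
    χ [ q ] r  ≡⟨ wave-low-strict W₁ uq inc₁≡ (trans c₁≡ (cong suc c₂≡0)) ⟩
    1          ∎))
    where
    open ≡-Reasoning
    c₁≡ = χ₁≡ [ q ] R₂≡
    c₂≡0 : χ [ m₂ ] r ≡ 0
    c₂≡0 = n≤0⇒n≡0 (≤-pred (subst (_≤ 1) c₁≡ (χ-≤-1 m₁ r)))
    m₂≡q : m₂ ≡ q
    m₂≡q = just-injective (trans (sym (head-reverse W₂.top W₂.dec)) (cong head R₂≡))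
  ... | q ∷ q′ ∷ mid , _ , R₂≡ with subst (_≤ 1) (χ₁≡ (q ∷ q′ ∷ mid) R₂≡) (χ-≤-1 m₁ r)
  ...   | s≤s ()

wave-unique : ∀ {u₁ u₂ r} → Wave 0 u₁ r → Wave 0 u₂ r → sort u₁ ≡ sort u₂ →
              des u₁ + χ u₁ r ≡ des u₂ + χ u₂ r → Unique (u₁ ++ r) → Unique (u₂ ++ r) → u₁ ≡ u₂
wave-unique W₁ W₂ sort≡ srdes≡ uq₁ uq₂ with ≤-total (length (Wave.dec W₁)) (length (Wave.dec W₂))
... | inj₁ k₁≤k₂ = wave-unique-≤ W₁ W₂ sort≡ srdes≡ uq₁ k₁≤k₂
... | inj₂ k₂≤k₁ = sym (wave-unique-≤ W₂ W₁ (sym sort≡) (sym srdes≡) uq₂ k₂≤k₁)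

θ-nonempty : ∀ x xs → [] ≢ θ (x ∷ xs)
θ-nonempty x xs e = 0≢1+n (trans (cong length e) (↭.↭-length (θ-↭ (x ∷ xs))))

des-whole : ∀ w → srdes w ≡ 0 → srwRest w ≡ [] → des w ≡ 0
des-whole w srdes≡0 rest≡[] = trans (des-srw w) (cong₂ (λ d r → d + des r) srdes≡0 rest≡[])

θ-whole≢θ-hooked : ∀ {u v} → InW u → InW v → srdes u ≡ 0 → srwRest u ≡ [] →
                   Hook (δ (srdes v) (srw v)) → inv (δ (srdes v) (srw v)) ≡ srdes v → θ u ≢ θ v
θ-whole≢θ-hooked {u} {v} iu iv srdes≡0 rest≡[] hk inv≡ e = <⇒≢ (hooked⇒des-positive v hk inv≡) (begin
  0         ≡⟨ des-whole u srdes≡0 rest≡[] ⟨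
  des u     ≡⟨ des≡lec∘θ u iu ⟩
  lec (θ u) ≡⟨ cong lec e ⟩
  lec (θ v) ≡⟨ des≡lec∘θ v iv ⟨
  des v     ∎)
  where open ≡-Reasoning

θ-injective : ∀ u v → InW u → InW v → θ u ≡ θ v → u ≡ v
θ-injective = srw-induction (λ u → ∀ v → InW u → InW v → θ u ≡ θ v → u ≡ v) base step
  where
  base : ∀ v → InW [] → InW v → [] ≡ θ v → [] ≡ v
  base []       _ _ _ = refl
  base (y ∷ ys) _ _ e = ⊥-elim (θ-nonempty y ys e)
  step : ∀ x xs →
         (∀ v → InW (srwRest (x ∷ xs)) → InW v → θ (srwRest (x ∷ xs)) ≡ θ v → srwRest (x ∷ xs) ≡ v) →
         ∀ v → InW (x ∷ xs) → InW v → θ (x ∷ xs) ≡ θ v → x ∷ xs ≡ v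
  step x xs ih []       _  _  e = ⊥-elim (θ-nonempty x xs (sym e))
  step x xs ih (y ∷ ys) iu iv e with block x xs iu | block y ys iv
  ... | whole s₁ r₁ | whole s₂ r₂ = trans (sym (θ-whole x xs s₁ r₁)) (trans e (θ-whole y ys s₂ r₂))
  ... | whole s₁ r₁ | hooked hk inv≡ = ⊥-elim (θ-whole≢θ-hooked iu iv s₁ r₁ hk inv≡ e)
  ... | hooked hk inv≡ | whole s₂ r₂ = ⊥-elim (θ-whole≢θ-hooked iv iu s₂ r₂ hk inv≡ (sym e))
  ... | hooked hk₁ inv₁ | hooked hk₂ inv₂ = begin
    x ∷ xs             ≡⟨ srw-++-srwRest u ⟨
    srw u ++ srwRest u ≡⟨ cong₂ _++_ srw≡ rest≡ ⟩
    srw v ++ srwRest v ≡⟨ srw-++-srwRest v ⟩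
    y ∷ ys             ∎
    where
    open ≡-Reasoning
    u = x ∷ xs
    v = y ∷ ys
    h₁ = δ (srdes u) (srw u)
    h₂ = δ (srdes v) (srw v)
    split≡ : θ (srwRest u) ≡ θ (srwRest v) × h₁ ≡ h₂
    split≡ = hook-suffix-unique (trans (sym (θ-unfold x xs)) (trans e (θ-unfold y ys))) hk₁ hk₂
    rest≡ : srwRest u ≡ srwRest v
    rest≡ = ih (srwRest v) (proj₂ (InW-srw u iu)) (proj₂ (InW-srw v iv)) (proj₁ split≡)
    srdes≡ : srdes u ≡ srdes v
    srdes≡ = trans (sym inv₁) (trans (cong inv (proj₂ split≡)) inv₂)
    srw≡ : srw u ≡ srw v
    srw≡ = wave-unique (wave x xs) (subst (Wave 0 (srw v)) (sym rest≡) (wave y ys))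
             (δ≡δ⇒sort≡ (srdes u) (srdes v) (srw u) (srw v) (proj₂ split≡))
             (trans srdes≡ (cong (λ r → des (srw v) + χ (srw v) r) (sym rest≡)))
             (subst Unique (sym (srw-++-srwRest u)) (proj₂ iu))
             (subst (λ r → Unique (srw v ++ r)) (sym rest≡) (subst Unique (sym (srw-++-srwRest v)) (proj₂ iv)))

-- Surjectivity

θ-sorted : ∀ v → Sorted v → InW v → θ v ≡ v
θ-sorted []       _ _  = refl
θ-sorted (x ∷ xs) s iv with block x xs iv
... | whole srdes≡0 rest≡[] = θ-whole x xs srdes≡0 rest≡[]
... | hooked hk inv≡        = ⊥-elim (<⇒≢ (hooked⇒des-positive (x ∷ xs) hk inv≡) (sym (des-sorted s)))

θ-split : ∀ x xs {u r} → srwSplit (x ∷ xs) ≡ (u , r) → θ (x ∷ xs) ≡ θ r ++ δ (des u + χ u r) u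
θ-split x xs split≡ = trans (θ-unfold x xs)
  (cong₂ (λ u r → θ r ++ δ (des u + χ u r) u) (cong proj₁ split≡) (cong proj₂ split≡))

θ-++-wave : ∀ {u r} → Wave 0 u r → θ (u ++ r) ≡ θ r ++ δ (des u + χ u r) u
θ-++-wave {r = r} W@record { inc = []    ; top = top ; dec = dec ; split = refl } =
  θ-split top (dec ++ r) (srwSplit-wave W)
θ-++-wave {r = r} W@record { inc = i ∷ inc ; top = top ; dec = dec ; split = refl } =
  θ-split i ((inc ++ top ∷ dec) ++ r) (srwSplit-wave W)

sorted-wave : ∀ A b B {r} → AllPairs _<_ (A ++ b ∷ B) → All (1 ≤_) (b ∷ B) → Stop (lastOr 0 A) b (length B) r →
              Wave 0 (A ++ reverse (b ∷ B)) r ×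
              des (A ++ reverse (b ∷ B)) + χ (A ++ reverse (b ∷ B)) r ≡ length B + χ [ b ] r
sorted-wave A b B {r} ap positive st with reverse-view b B | AllPairs-++⁻ A ap
... | top , dec , rev≡ , m≡b , k≡ | apA , apbB , cross = W , srdes≡
  where
  to-run : ∀ {P : ℕ → Set} → All P (b ∷ B) → All P (top ∷ dec)
  to-run = subst (All _) rev≡ ∘ ↭.All-resp-↭ (↭-sym (↭.↭-reverse (b ∷ B)))
  W : Wave 0 (A ++ reverse (b ∷ B)) r
  W = record
    { inc = A ; top = top ; dec = dec ; split = cong (A ++_) rev≡
    ; increasing = strict⇒sorted
        (AllPairs.++⁺ apA ([] ∷ []) (All.map (λ a<bB → All.head (to-run a<bB) ∷ []) cross))
    ; decreasing = subst (Linked _>_) rev≡ (Linked.AllPairs⇒Linked (reverse-increasing apbB))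
    ; above = All.tail (to-run (All-lastOr-< 0 A positive cross))
    ; stops = subst₂ (λ m k → Stop (lastOr 0 A) m k r) (sym m≡b) (sym k≡) st }
  srdes≡ : des (A ++ reverse (b ∷ B)) + χ (A ++ reverse (b ∷ B)) r ≡ length B + χ [ b ] r
  srdes≡ = trans (cong₂ _+_ (des-wave W) (χ-wave W)) (cong₂ (λ k m → k + χ [ m ] r) k≡ m≡b)

-- A wave on the letters A < y < b < B with srdes 1 + length B: y ends the run, unless the next
-- letter descends below y, in which case y ends the increasing part instead.
module _ (A : Word) (y b : ℕ) (B : Word)
         (strict : AllPairs _<_ (A ++ y ∷ b ∷ B)) (positive : All (1 ≤_) (A ++ y ∷ b ∷ B)) where

  long-run : ∀ {r} → Stop (lastOr 0 A) y (suc (length B)) r → χ [ y ] r ≡ 0 →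
             ∃ λ u → Wave 0 u r × u ↭ A ++ y ∷ b ∷ B × des u + χ u r ≡ suc (length B)
  long-run {r} st χ≡0 with sorted-wave A y (b ∷ B) strict (All.++⁻ʳ A positive) st
  ... | W , srdes≡ = A ++ reverse (y ∷ b ∷ B) , W , ↭.++⁺ˡ A (↭.↭-reverse (y ∷ b ∷ B)) ,
                     trans srdes≡ (trans (cong (suc (length B) +_) χ≡0) (+-identityʳ _))

  short-run : ∀ {r} → Stop (lastOr 0 (A ++ [ y ])) b (length B) r → χ [ b ] r ≡ 1 →
              ∃ λ u → Wave 0 u r × u ↭ A ++ y ∷ b ∷ B × des u + χ u r ≡ suc (length B)
  short-run {r} st χ≡1
    with sorted-wave (A ++ [ y ]) b B (subst (AllPairs _<_) (sym (++-assoc A [ y ] (b ∷ B))) strict)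
                     (All.tail (All.++⁻ʳ A positive)) st
  ... | W , srdes≡ = (A ++ [ y ]) ++ reverse (b ∷ B) , W ,
                     ↭-trans (↭.++⁺ˡ (A ++ [ y ]) (↭.↭-reverse (b ∷ B)))
                             (↭-reflexive (++-assoc A [ y ] (b ∷ B))) ,
                     trans srdes≡ (trans (cong (length B +_) χ≡1) (+-comm (length B) 1))

wave-with-srdes : ∀ S d r → AllPairs _<_ S → All (1 ≤_) S → 1 ≤ d → d < length S →
                  All (λ f → All (f ≢_) S) r →
                  ∃ λ u → Wave 0 u r × u ↭ S × des u + χ u r ≡ d
wave-with-srdes S d r strict positive 1≤d d<|S| fresh with split-from-end d S d<|S|
... | A , y , []    , refl , refl = ⊥-elim (1+n≰n 1≤d)
... | A , y , b ∷ B , refl , refl = choose r fresh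
  where
  S′ = A ++ y ∷ b ∷ B
  y<b : y < b
  y<b with AllPairs-++⁻ A strict
  ... | _ , (y<b ∷ _) ∷ _ , _ = y<b
  choose : ∀ r → All (λ f → All (f ≢_) S′) r →
           ∃ λ u → Wave 0 u r × u ↭ S′ × des u + χ u r ≡ suc (length B)
  choose []      _ = long-run A y b B strict positive end refl
  choose (f ∷ t) (f-fresh ∷ _) with <-cmp f y
  ... | tri< f<y _ _ = short-run A y b B strict positive
                         (low (<-trans f<y y<b) (subst (f ≤_) (sym (lastOr-++-∷ 0 A y)) (<⇒≤ f<y)))
                         (χ-below t (<-trans f<y y<b))
  ... | tri≈ _ f≡y _ = ⊥-elim (All.lookup f-fresh (∈-++⁺ʳ A (here refl)) f≡y)
  ... | tri> _ _ y<f = long-run A y b B strict positive (ascent (s≤s z≤n) (<⇒≤ y<f)) (χ-above t (<⇒≤ y<f))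

θ-extend-normal : ∀ {p pre a post} w′ → AllPairs _<_ (pre ++ a ∷ post) → 1 ≤ length pre →
                  InW (p ++ a ∷ pre ++ post) → θ w′ ≡ p → ∃ λ w → InW w × θ w ≡ p ++ a ∷ pre ++ post
θ-extend-normal {p} {pre} {a} {post} w′ strict 1≤|pre| iph θw′≡p =
  extend (wave-with-srdes S (length pre) w′ strict positive 1≤|pre| |pre|<|S| fresh)
  where
  S = pre ++ a ∷ post
  h↭S : a ∷ pre ++ post ↭ S
  h↭S = ↭-sym (↭.shift a pre post)
  w′↭p : w′ ↭ p
  w′↭p = subst (w′ ↭_) θw′≡p (↭-sym (θ-↭ w′))
  positive : All (1 ≤_) S
  positive = ↭.All-resp-↭ h↭S (All.++⁻ʳ p (proj₁ iph))
  |pre|<|S| : length pre < length S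
  |pre|<|S| = subst (length pre <_) (sym (length-++ pre)) (m<m+n (length pre) (s≤s z≤n))
  fresh : All (λ f → All (f ≢_) S) w′
  fresh = ↭.All-resp-↭ (↭-sym w′↭p)
            (All.map (↭.All-resp-↭ h↭S) (proj₂ (proj₂ (AllPairs-++⁻ p (proj₂ iph)))))
  extend : (∃ λ u → Wave 0 u w′ × u ↭ S × des u + χ u w′ ≡ length pre) →
           ∃ λ w → InW w × θ w ≡ p ++ a ∷ pre ++ post
  extend (u , W , u↭S , srdes≡) = u ++ w′ , InW-↭ (↭-sym w↭p++h) iph , (begin
    θ (u ++ w′)                  ≡⟨ θ-++-wave W ⟩
    θ w′ ++ δ (des u + χ u w′) u ≡⟨ cong₂ (λ q d → q ++ δ d u) θw′≡p srdes≡ ⟩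
    p ++ δ (length pre) u        ≡⟨ cong (p ++_) (δ-at u pre a post sort-u) ⟩
    p ++ a ∷ pre ++ post         ∎)
    where
    open ≡-Reasoning
    w↭p++h : u ++ w′ ↭ p ++ a ∷ pre ++ post
    w↭p++h = ↭-trans (↭.++⁺ (↭-trans u↭S (↭-sym h↭S)) w′↭p) (↭.++-comm (a ∷ pre ++ post) p)
    sort-u : sort u ≡ S
    sort-u = ↗↭↗⇒≡ (sort-↗ u) (strict⇒sorted strict) (↭-trans (sort-↭ u) u↭S)

θ-extend : ∀ {p h} w′ → Hook h → InW (p ++ h) → θ w′ ≡ p → ∃ λ w → InW w × θ w ≡ p ++ h
θ-extend {p} w′ hk iph θw′≡p with hook-normal-form hk (proj₁ (proj₂ (AllPairs-++⁻ p (proj₂ iph))))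
... | pre , a , post , refl , strict , 1≤|pre| = θ-extend-normal w′ strict 1≤|pre| iph θw′≡p

θ-surjective : ∀ v → InW v → ∃ λ w → InW w × θ w ≡ v
θ-surjective v = go (hookFactorization v)
  where
  go : ∀ {v} → HookFactorization v → InW v → ∃ λ w → InW w × θ w ≡ v
  go {v} (initial s) iv = v , iv , θ-sorted v s iv
  go (_⊳_ {p} f hk) iv with go f (proj₁ (InW-++⁻ p iv))
  ... | w′ , _ , θw′≡p = θ-extend w′ hk iv θw′≡p

InS⇒InW : ∀ {n w} → InS n w → InW w
InS⇒InW {n} w↭1⋯n = InW-↭ (↭-sym w↭1⋯n)
  (All.map⁺ (All.universal (λ _ → s≤s z≤n) (upTo n)) , Unique.map⁺ suc-injective (Unique.upTo⁺ n))

θ-InS : ∀ {n} w → InS n w → InS n (θ w)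
θ-InS w w↭1⋯n = ↭-trans (θ-↭ w) w↭1⋯n

θ-surjective-InS : ∀ n v → InS n v → ∃ λ w → InS n w × θ w ≡ v
θ-surjective-InS n v v↭1⋯n with θ-surjective v (InS⇒InW v↭1⋯n)
... | w , _ , θw≡v = w , ↭-trans (↭-sym (θ-↭ w)) (subst (_↭ _) (sym θw≡v) v↭1⋯n) , θw≡v

theorem4p13 : ((w : Word) → InW w → InW (θ w))
    × ((u v : Word) → InW u → InW v → θ u ≡ θ v → u ≡ v)
    × ((v : Word) → InW v → Σ Word (λ w → InW w × θ w ≡ v))
    × ((w : Word) → InW w → des w ≡ lec (θ w))
    × ((n : ℕ) → (w : Word) → InS n w → InS n (θ w))
    × ((n : ℕ) → (v : Word) → InS n v → Σ Word (λ w → InS n w × θ w ≡ v))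
theorem4p13 =
    (λ w → InW-↭ (↭-sym (θ-↭ w)))
  , θ-injective
  , θ-surjective
  , des≡lec∘θ
  , (λ _ → θ-InS)
  , θ-surjective-InS
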